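{- Let $s>t>0$ be integers, let $g=\frac{s-1}{\gcd(s-1,t)}$ with prime factorization $g=p_1^{j_1}\cdots p_n^{j_n}$ (distinct primes, $j_i\ge 1$), let $k$ be a positive integer with $\gcd(k,gs)=1$, and let $e_1,\dots,e_n\ge 0$ be integers with $r=p_1^{e_1}\cdots p_n^{e_n}k\ge 2$. Then $r$ is distinguished with respect to $(s,t)$ if and only if for each $i=1,\dots,n$ at least one of the following holds: (1) $j_i+e_i\le \nu_{p_i}(s-1)$; (2) $p_i=2$ and $\nu_2(s-1)<e_i<e_i+j_i\le\nu_2(s^2-1)$; (3) $\operatorname{ord}_{p_i^{e_i+j_i}}(s)$ divides $\operatorname{ord}_k(s)$.
   Context: For integers $s$ and $r\ge 1$ with $\gcd(r,s)=1$, $\operatorname{ord}_r(s)$ denotes the least positive integer $m$ with $s^m\equiv 1\pmod r$. For integers $s\ge 2$ and $t$, an integer $r\ge 2$ is distinguished with respect to $(s,t)$ if $\gcd(r,s)=1$ and $r$ divides $t\cdot\frac{s^{\operatorname{ord}_r(s)}-1}{s-1}$. For a prime $p$ and positive integer $m$, $\nu_p(m)$ is the exponent of $p$ in $m$. -}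

module Defs where

open import Data.Nat using (ℕ; zero; suc; _+_; _*_; _∸_; _^_; _≤_; _<_)
open import Data.Nat.DivMod using (_/_)
open import Data.Nat.Divisibility using (_∣_; _∣?_)
open import Data.Nat.Coprimality using (Coprime)
open import Data.Nat.GCD using (gcd)
open import Data.Fin using (Fin; zero; suc)
open import Data.Product using (_×_)
open import Relation.Nullary using (¬_; yes; no)

quot : ℕ → ℕ → ℕ
quot a zero    = 0
quot a (suc b) = a / suc b

prodF : (n : ℕ) → (Fin n → ℕ) → ℕ
prodF zero    f = 1
prodF (suc n) f = f zero * prodF n (λ i → f (suc i))

-- ord_r(s) = m, stated relationally: m is the least positive integer with
-- s^m ≡ 1 (mod r).  (We only use it with s ≥ 1, so s^m ≥ 1 and
-- "s^m ≡ 1 mod r" is exactly r ∣ s^m ∸ 1.)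
IsOrd : ℕ → ℕ → ℕ → Set
IsOrd r s m = (0 < m) × (r ∣ s ^ m ∸ 1)
            × (∀ m′ → 0 < m′ → m′ < m → ¬ (r ∣ s ^ m′ ∸ 1))

repunit : ℕ → ℕ → ℕ
repunit s m = quot (s ^ m ∸ 1) (s ∸ 1)

Distinguished : ℕ → ℕ → ℕ → Set
Distinguished r s t =
  (2 ≤ r) × Coprime r s × (∀ m → IsOrd r s m → r ∣ t * repunit s m)

-- p-adic valuation ν_p(m) for p ≥ 2 and m ≥ 1 (largest e with p^e ∣ m);
-- by convention 0 when p < 2 or m = 0 (never used in those cases).
private
  νgo : ℕ → ℕ → ℕ → ℕ
  νgo q zero    m = 0
  νgo q (suc f) m with suc (suc q) ∣? m
  ... | yes _ = suc (νgo q f (m / suc (suc q)))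
  ... | no  _ = 0

ν : ℕ → ℕ → ℕ
ν zero          m       = 0
ν (suc zero)    m       = 0
ν (suc (suc q)) zero    = 0
ν (suc (suc q)) (suc m) = νgo q (suc m) (suc m)

gOf : ℕ → ℕ → ℕ
gOf s t = quot (s ∸ 1) (gcd (s ∸ 1) t)

module Submission where

-- Write s − 1 = d g and t = d t′ with d = gcd(s − 1, t). Since s ^ m − 1 = (s − 1) R_m with R_m the
-- repunit, r ∣ t R_m amounts to p_i ^ (e_i + j_i) ∣ s ^ m − 1 for all i together with k ∣ s ^ m − 1.
-- For m = ord_r s the first condition is governed by the lifting-the-exponent lemma: multiplying
-- the exponent by q = p_i raises ν_q(s ^ n − 1) by exactly one (q odd, or 4 ∣ s − 1; for q = 2 one
-- starts from s ^ 2 − 1), and multiplying it by a number prime to q does not change it. Hence the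
-- q-part of ord_r s is the larger of the q-part of ord_k s, which gives (3), and the least q ^ γ
-- with q ^ e ∣ s ^ (q ^ γ) − 1, which q ^ (e + j) divides only in cases (1) and (2).
-- Conversely each of (1)–(3) yields p_i ^ (e_i + j_i) ∣ s ^ m − 1 whenever r ∣ s ^ m − 1.

open import Defs
open import Data.Fin as Fin using (Fin; toℕ; fromℕ<)
open import Data.Fin.Properties using (pigeonhole; toℕ-fromℕ<)
import Data.Fin.Properties as Finₚ
open import Data.Nat
  using ( ℕ; zero; suc; _+_; _*_; _∸_; _^_; _≤_; _<_; z≤n; s≤s; s≤s⁻¹; z<s
        ; NonZero; >-nonZero; ≢-nonZero; nonTrivial⇒≢1; nonTrivial⇒n>1)
open import Data.Nat.Coprimality as Coprime
  using (Coprime; coprime-divisor; 1-coprimeTo; prime⇒coprime; coprime-/gcd)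
open import Data.Nat.Divisibility
open import Data.Nat.DivMod
  using (_/_; _%_; m≡m%n+[m/n]*n; m%n<n; m*n/n≡m; m*[n/m]≡n; m≥n⇒m/n>0; m/n<m)
open import Data.Nat.GCD using (gcd; gcd[m,n]∣m; gcd[m,n]∣n; gcd[m,n]≢0)
open import Data.Nat.Induction using (<-rec)
open import Data.Nat.Primality
  using (Prime; prime⇒irreducible; prime⇒nonZero; prime⇒nonTrivial; prime[2]; euclidsLemma)
open import Data.Nat.Properties
open import Data.Nat.Tactic.RingSolver using (solve-∀)
open import Data.Product using (_×_; ∃; _,_; proj₁; proj₂)
open import Data.Sum using (_⊎_; inj₁; inj₂; [_,_]′)
open import Function using (_∘_)
open import Function.Bundles using (_⇔_; mk⇔; Equivalence)
open import Function.Construct.Composition using (_⇔-∘_)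
open import Relation.Nullary using (¬_; Dec; yes; no; contradiction)
open import Relation.Nullary.Decidable using (_×-dec_)
open import Relation.Unary using (Decidable)
open import Relation.Binary.PropositionalEquality
  using (_≡_; _≢_; refl; sym; trans; cong; cong₂; subst; subst₂; module ≡-Reasoning)

open Equivalence using (to; from)

private variable
  a b c e j k m n q s u w x : ℕ

coprime-*ʳ : Coprime a b → Coprime a c → Coprime a (b * c)
coprime-*ʳ ab ac (d∣a , d∣bc) =
  ac (d∣a , coprime-divisor (λ (e∣d , e∣b) → ab (∣-trans e∣d d∣a , e∣b)) d∣bc)

coprime-^ʳ : Coprime a b → ∀ i → Coprime a (b ^ i)
coprime-^ʳ ab zero    = Coprime.sym (1-coprimeTo _)
coprime-^ʳ ab (suc i) = coprime-*ʳ ab (coprime-^ʳ ab i)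

coprime-^ˡ : Coprime a b → ∀ i → Coprime (a ^ i) b
coprime-^ˡ ab i = Coprime.sym (coprime-^ʳ (Coprime.sym ab) i)

coprime-∣ʳ : Coprime a b → c ∣ b → Coprime a c
coprime-∣ʳ ab c∣b (d∣a , d∣c) = ab (d∣a , ∣-trans d∣c c∣b)

coprime-*-∣ : Coprime a b → a ∣ x → b ∣ x → a * b ∣ x
coprime-*-∣ {a} {b} ab (divides α refl) b∣αa =
  subst (a * b ∣_) (*-comm a α)
    (*-monoʳ-∣ a (coprime-divisor (Coprime.sym ab) (subst (b ∣_) (*-comm α a) b∣αa)))

∣n⇒coprime-1+n : a ∣ n → Coprime a (suc n)
∣n⇒coprime-1+n {n = n} a∣n {d} (d∣a , d∣1+n) =
  ∣1⇒≡1 (∣m+n∣m⇒∣n (subst (d ∣_) (+-comm 1 n) d∣1+n) (∣-trans d∣a a∣n))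

prime∤⇒coprime : Prime q → ¬ q ∣ n → Coprime q n
prime∤⇒coprime pq q∤n (d∣q , d∣n) with prime⇒irreducible pq d∣q
... | inj₁ d≡1    = d≡1
... | inj₂ refl   = contradiction d∣n q∤n

prime≢1 : Prime q → q ≢ 1
prime≢1 pq = nonTrivial⇒≢1 {{prime⇒nonTrivial pq}}

prime∤1+q* : Prime q → ∀ m → ¬ q ∣ 1 + q * m
prime∤1+q* {q} pq m q∣1+qm =
  prime≢1 pq (∣1⇒≡1 (∣m+n∣m⇒∣n (subst (q ∣_) (+-comm 1 (q * m)) q∣1+qm) (m∣m*n m)))

distinct-primes⇒coprime : ∀ {q q′} → Prime q → Prime q′ → q ≢ q′ → Coprime q q′
distinct-primes⇒coprime pq pq′ q≢q′ =
  prime∤⇒coprime pq (λ q∣q′ → [ prime≢1 pq , q≢q′ ]′ (prime⇒irreducible pq′ q∣q′))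

q∣q^ : ∀ q → 0 < j → q ∣ q ^ j
q∣q^ {j = suc j} q _ = m∣m*n (q ^ j)

^-monoʳ-∣ : ∀ q → a ≤ b → q ^ a ∣ q ^ b
^-monoʳ-∣ {a} {b} q a≤b =
  subst (q ^ a ∣_) (trans (sym (^-distribˡ-+-* q a (b ∸ a))) (cong (q ^_) (m+[n∸m]≡n a≤b)))
    (m∣m*n (q ^ (b ∸ a)))

prodF-pos : ∀ n (f : Fin n → ℕ) → (∀ i → 0 < f i) → 0 < prodF n f
prodF-pos zero    f f>0 = z<s
prodF-pos (suc n) f f>0 = *-mono-≤ (f>0 Fin.zero) (prodF-pos n (f ∘ Fin.suc) (f>0 ∘ Fin.suc))

∣prodF : ∀ n (f : Fin n → ℕ) i → f i ∣ prodF n f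
∣prodF (suc n) f Fin.zero    = m∣m*n _
∣prodF (suc n) f (Fin.suc i) = ∣n⇒∣m*n (f Fin.zero) (∣prodF n (f ∘ Fin.suc) i)

coprime-prodF : ∀ n (f : Fin n → ℕ) → (∀ i → Coprime a (f i)) → Coprime a (prodF n f)
coprime-prodF zero    f cop = Coprime.sym (1-coprimeTo _)
coprime-prodF (suc n) f cop = coprime-*ʳ (cop Fin.zero) (coprime-prodF n (f ∘ Fin.suc) (cop ∘ Fin.suc))

prodF-∣ : ∀ n (f : Fin n → ℕ) → (∀ i l → i ≢ l → Coprime (f i) (f l)) →
          (∀ i → f i ∣ x) → prodF n f ∣ x
prodF-∣ zero    f cop f∣x = 1∣ _
prodF-∣ (suc n) f cop f∣x = coprime-*-∣
  (coprime-prodF n (f ∘ Fin.suc) (λ i → cop Fin.zero (Fin.suc i) λ ()))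
  (f∣x Fin.zero)
  (prodF-∣ n (f ∘ Fin.suc) (λ i l i≢l → cop (Fin.suc i) (Fin.suc l) (i≢l ∘ Finₚ.suc-injective)) (f∣x ∘ Fin.suc))

prodF-split : ∀ n (f : Fin n → ℕ) i → (∀ l → l ≢ i → Coprime a (f l)) →
              ∃ λ c → prodF n f ≡ f i * c × Coprime a c
prodF-split (suc n) f Fin.zero cop =
  prodF n (f ∘ Fin.suc) , refl , coprime-prodF n (f ∘ Fin.suc) (λ l → cop (Fin.suc l) λ ())
prodF-split (suc n) f (Fin.suc i) cop
  with prodF-split n (f ∘ Fin.suc) i (λ l l≢i → cop (Fin.suc l) (l≢i ∘ Finₚ.suc-injective))
... | c , eq , a⊥c =
  f Fin.zero * c , trans (cong (f Fin.zero *_) eq) (x*[y*z]≡y*[x*z] (f Fin.zero) (f (Fin.suc i)) c) ,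
  coprime-*ʳ (cop Fin.zero λ ()) a⊥c
  where
  x*[y*z]≡y*[x*z] : ∀ x y z → x * (y * z) ≡ y * (x * z)
  x*[y*z]≡y*[x*z] = solve-∀

geomSum : ℕ → ℕ → ℕ
geomSum x zero    = 0
geomSum x (suc c) = 1 + x * geomSum x c

^≡1+pred*geomSum : ∀ u c → suc u ^ c ≡ suc (u * geomSum (suc u) c)
^≡1+pred*geomSum u zero    = cong suc (sym (*-zeroʳ u))
^≡1+pred*geomSum u (suc c) = begin
  suc u * suc u ^ c                          ≡⟨ cong (suc u *_) (^≡1+pred*geomSum u c) ⟩
  suc u * suc (u * geomSum (suc u) c)        ≡⟨ step u (geomSum (suc u) c) ⟩
  suc (u * (1 + suc u * geomSum (suc u) c))  ∎
  where
  open ≡-Reasoning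
  step : ∀ u g → suc u * suc (u * g) ≡ suc (u * (1 + suc u * g))
  step = solve-∀

^∸1≡pred*geomSum : ∀ s c → s ^ c ∸ 1 ≡ (s ∸ 1) * geomSum s c
^∸1≡pred*geomSum zero    zero    = refl
^∸1≡pred*geomSum zero    (suc c) = refl
^∸1≡pred*geomSum (suc u) c       = cong (_∸ 1) (^≡1+pred*geomSum u c)

suc[^∸1]≡^ : ∀ s .{{_ : NonZero s}} a → suc (s ^ a ∸ 1) ≡ s ^ a
suc[^∸1]≡^ s a = trans (+-comm 1 _) (m∸n+n≡m (m^n>0 s a))

^1∸1≡∸1 : ∀ s → s ^ 1 ∸ 1 ≡ s ∸ 1
^1∸1≡∸1 s = cong (_∸ 1) (*-identityʳ s)

^*∸1≡ : ∀ s .{{_ : NonZero s}} a c →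
        s ^ (a * c) ∸ 1 ≡ (s ^ a ∸ 1) * geomSum (suc (s ^ a ∸ 1)) c
^*∸1≡ s a c = begin
  s ^ (a * c) ∸ 1                              ≡⟨ cong (_∸ 1) (sym (^-*-assoc s a c)) ⟩
  (s ^ a) ^ c ∸ 1                              ≡⟨ cong (λ z → z ^ c ∸ 1) (sym (suc[^∸1]≡^ s a)) ⟩
  suc (s ^ a ∸ 1) ^ c ∸ 1                      ≡⟨ ^∸1≡pred*geomSum (suc (s ^ a ∸ 1)) c ⟩
  (s ^ a ∸ 1) * geomSum (suc (s ^ a ∸ 1)) c    ∎
  where open ≡-Reasoning

^+∸1≡ : ∀ s .{{_ : NonZero s}} a b → s ^ (a + b) ∸ 1 ≡ s ^ b * (s ^ a ∸ 1) + (s ^ b ∸ 1)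
^+∸1≡ s a b = begin
  s ^ (a + b) ∸ 1                       ≡⟨ cong (_∸ 1) (^-distribˡ-+-* s a b) ⟩
  s ^ a * s ^ b ∸ 1                     ≡⟨ cong₂ (λ x y → x * y ∸ 1) (sym (suc[^∸1]≡^ s a)) (sym (suc[^∸1]≡^ s b)) ⟩
  suc A * suc B ∸ 1                     ≡⟨ step A B ⟩
  suc B * A + B                         ≡⟨ cong (λ z → z * A + B) (suc[^∸1]≡^ s b) ⟩
  s ^ b * A + B                         ∎
  where
  open ≡-Reasoning
  A = s ^ a ∸ 1
  B = s ^ b ∸ 1
  step : ∀ A B → B + A * suc B ≡ suc B * A + B
  step = solve-∀

^∸1-monoʳ-∣ : ∀ s .{{_ : NonZero s}} → a ∣ n → s ^ a ∸ 1 ∣ s ^ n ∸ 1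
^∸1-monoʳ-∣ {a} s (divides c refl) =
  subst (s ^ a ∸ 1 ∣_) (sym (trans (cong (λ z → s ^ z ∸ 1) (*-comm c a)) (^*∸1≡ s a c))) (m∣m*n _)

^+∸^≡ : ∀ s a d → s ^ (a + d) ∸ s ^ a ≡ s ^ a * (s ^ d ∸ 1)
^+∸^≡ s a d = begin
  s ^ (a + d) ∸ s ^ a            ≡⟨ cong (_∸ s ^ a) (^-distribˡ-+-* s a d) ⟩
  s ^ a * s ^ d ∸ s ^ a          ≡⟨ cong (s ^ a * s ^ d ∸_) (sym (*-identityʳ (s ^ a))) ⟩
  s ^ a * s ^ d ∸ s ^ a * 1      ≡⟨ sym (*-distribˡ-∸ (s ^ a) (s ^ d) 1) ⟩
  s ^ a * (s ^ d ∸ 1)            ∎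
  where open ≡-Reasoning

module _ {P : ℕ → Set} (P? : Decidable P) where

  LeastPositive : ℕ → Set
  LeastPositive m = 0 < m × P m × (∀ m′ → 0 < m′ → m′ < m → ¬ P m′)

  least-positive : ∀ n → 0 < n → P n → ∃ LeastPositive
  least-positive = <-rec (λ n → 0 < n → P n → ∃ LeastPositive) step
    where
    step : ∀ n → (∀ {m} → m < n → 0 < m → P m → ∃ LeastPositive) → 0 < n → P n → ∃ LeastPositive
    step n rec n>0 pn with anyUpTo? (λ m → 0 <? m ×-dec P? m) n
    ... | yes (m , m<n , m>0 , pm) = rec m<n m>0 pm
    ... | no  none = n , n>0 , pn , λ m′ m′>0 m′<n pm′ → none (m′ , m′<n , m′>0 , pm′)

IsOrd-∣ : .{{_ : NonZero s}} → IsOrd k s m → k ∣ s ^ n ∸ 1 → m ∣ n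
IsOrd-∣ {s} {k} {m} {n} (m>0 , k∣ord , minimal) k∣n =
  m%n≡0⇒n∣m n m (remainder≡0 (m%n<n n m) k∣remainder)
  where
  instance
    m≢0 : NonZero m
    m≢0 = >-nonZero m>0
  n≡ : n ≡ n / m * m + n % m
  n≡ = trans (m≡m%n+[m/n]*n n m) (+-comm (n % m) _)
  k∣remainder : k ∣ s ^ (n % m) ∸ 1
  k∣remainder = ∣m+n∣m⇒∣n
    (subst (k ∣_) (trans (cong (λ z → s ^ z ∸ 1) n≡) (^+∸1≡ s (n / m * m) (n % m))) k∣n)
    (∣n⇒∣m*n (s ^ (n % m)) (∣-trans k∣ord (^∸1-monoʳ-∣ s (n∣m*n (n / m)))))
  remainder≡0 : ∀ {ρ} → ρ < m → k ∣ s ^ ρ ∸ 1 → ρ ≡ 0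
  remainder≡0 {zero}  _   _  = refl
  remainder≡0 {suc ρ} ρ<m k∣ = contradiction k∣ (minimal (suc ρ) z<s ρ<m)

%≡%⇒∣∸ : ∀ a b r .{{_ : NonZero r}} → a % r ≡ b % r → r ∣ b ∸ a
%≡%⇒∣∸ a b r eq = divides (b / r ∸ a / r) (begin
  b ∸ a                                         ≡⟨ cong₂ _∸_ (m≡m%n+[m/n]*n b r) (m≡m%n+[m/n]*n a r) ⟩
  (b % r + b / r * r) ∸ (a % r + a / r * r)     ≡⟨ cong (λ z → (b % r + b / r * r) ∸ (z + a / r * r)) eq ⟩
  (b % r + b / r * r) ∸ (b % r + a / r * r)     ≡⟨ [m+n]∸[m+o]≡n∸o (b % r) _ _ ⟩
  b / r * r ∸ a / r * r                         ≡⟨ sym (*-distribʳ-∸ r (b / r) (a / r)) ⟩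
  (b / r ∸ a / r) * r                           ∎)
  where open ≡-Reasoning

-- Among the residues of s ^ 0, …, s ^ k two coincide; cancelling the smaller power
-- (a unit mod k) leaves s ^ (j − i) ≡ 1 (mod k).
∃-^∸1 : 0 < k → Coprime k s → ∃ λ n → 0 < n × k ∣ s ^ n ∸ 1
∃-^∸1 {suc k} {s} _ cop with pigeonhole (n<1+n (suc k)) residue
  where
  residue : Fin (suc (suc k)) → Fin (suc k)
  residue i = fromℕ< (m%n<n (s ^ toℕ i) (suc k))
... | i , j , i<j , residues≡ = toℕ j ∸ toℕ i , m<n⇒0<n∸m i<j , k∣^∸1
  where
  α = toℕ i
  δ = toℕ j ∸ toℕ i
  k∣^j∸^i : suc k ∣ s ^ (α + δ) ∸ s ^ α
  k∣^j∸^i = subst (λ z → suc k ∣ s ^ z ∸ s ^ α) (sym (m+[n∸m]≡n (<⇒≤ i<j)))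
    (%≡%⇒∣∸ (s ^ α) (s ^ toℕ j) (suc k)
      (trans (sym (toℕ-fromℕ< _)) (trans (cong toℕ residues≡) (toℕ-fromℕ< _))))
  k∣^∸1 : suc k ∣ s ^ δ ∸ 1
  k∣^∸1 = coprime-divisor (coprime-^ʳ cop α) (subst (suc k ∣_) (^+∸^≡ s α δ) k∣^j∸^i)

ord-exists : 0 < k → Coprime k s → ∃ (IsOrd k s)
ord-exists {k} {s} k>0 cop with ∃-^∸1 k>0 cop
... | n , n>0 , k∣ = least-positive (λ m → k ∣? s ^ m ∸ 1) n n>0 k∣

ValuationOf : ℕ → ℕ → ℕ → Set
ValuationOf q x v = ∀ c → q ^ c ∣ x ⇔ c ≤ v

-- `ν` unfolds to a fuel-driven loop that is private to `Defs`; `νstep` recovers the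
-- body of that loop by unification, so the loop can be analysed for arbitrary fuel.
private
  mutual
    νstep : ∀ q → ℕ → (x : ℕ) → Dec (suc (suc q) ∣ x) → ℕ
    νstep q = _

    ν-unfold : ∀ q m → ν (suc (suc q)) (suc m) ≡ νstep q m (suc m) (suc (suc q) ∣? suc m)
    ν-unfold q m with suc m | suc (suc q) ∣? suc m
    ... | _ | _ = refl

  νloop : ℕ → ℕ → ℕ → ℕ
  νloop q zero    x = 0
  νloop q (suc f) x = νstep q f x (suc (suc q) ∣? x)

  νstep-yes : ∀ q f x q∣x → νstep q f x (yes q∣x) ≡ suc (νloop q f (x / suc (suc q)))
  νstep-yes q zero    x _ = refl
  νstep-yes q (suc f) x _ = refl

  νloop-valuation : ∀ q f x → 0 < x → x ≤ f → ValuationOf (suc (suc q)) x (νloop q f x)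
  νloop-valuation q zero    x x>0 x≤0 = contradiction (≤-trans x>0 x≤0) λ ()
  νloop-valuation q (suc f) x x>0 x≤1+f with suc (suc q) ∣? x
  ... | no  Q∤x = λ where
      zero    → mk⇔ (λ _ → z≤n) (λ _ → 1∣ x)
      (suc c) → mk⇔ (λ Q^c∣x → contradiction (∣-trans (m∣m*n (suc (suc q) ^ c)) Q^c∣x) Q∤x) λ ()
  ... | yes Q∣x rewrite νstep-yes q f x Q∣x = λ where
      zero    → mk⇔ (λ _ → z≤n) (λ _ → 1∣ x)
      (suc c) → mk⇔
        (λ Q^1+c∣x → s≤s (to (IH c) (*-cancelˡ-∣ Q (subst (Q * Q ^ c ∣_) (sym Qx′≡x) Q^1+c∣x))))
        (λ c<v → subst (Q * Q ^ c ∣_) Qx′≡x (*-monoʳ-∣ Q (from (IH c) (s≤s⁻¹ c<v))))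
    where
    Q = suc (suc q)
    x′ = x / Q
    Qx′≡x : Q * x′ ≡ x
    Qx′≡x = m*[n/m]≡n Q∣x
    IH : ValuationOf Q x′ (νloop q f x′)
    IH = νloop-valuation q f x′
      (m≥n⇒m/n>0 (∣⇒≤ {{>-nonZero x>0}} Q∣x))
      (s≤s⁻¹ (≤-trans (m/n<m x Q {{>-nonZero x>0}} (s≤s (s≤s z≤n))) x≤1+f))

ν-valuation : 2 ≤ q → 0 < x → ValuationOf q x (ν q x)
ν-valuation {suc zero}    (s≤s ())
ν-valuation {suc (suc q)} {suc m} _ _ rewrite ν-unfold q m = νloop-valuation q (suc m) (suc m) z<s ≤-refl

^∣⇒≤ν : 2 ≤ q → 0 < x → q ^ c ∣ x → c ≤ ν q x
^∣⇒≤ν q≥2 x>0 = to (ν-valuation q≥2 x>0 _)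

≤ν⇒^∣ : 2 ≤ q → 0 < x → c ≤ ν q x → q ^ c ∣ x
≤ν⇒^∣ q≥2 x>0 = from (ν-valuation q≥2 x>0 _)

ν-factorisation : 2 ≤ q → 0 < x → ∃ λ x′ → x ≡ q ^ ν q x * x′ × ¬ q ∣ x′
ν-factorisation {q} {x} q≥2 x>0 with ≤ν⇒^∣ {c = ν q x} q≥2 x>0 ≤-refl
... | divides x′ x≡x′q^ν = x′ , trans x≡x′q^ν (*-comm x′ _) , q∤x′
  where
  q∤x′ : ¬ q ∣ x′
  q∤x′ (divides z refl) = 1+n≰n (^∣⇒≤ν q≥2 x>0 (divides z (trans x≡x′q^ν (*-assoc z q (q ^ ν q x)))))

triangle : ℕ → ℕ
triangle zero    = 0
triangle (suc c) = c + triangle c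

2*triangle≡ : ∀ c → 2 * triangle (suc c) ≡ suc c * c
2*triangle≡ zero    = refl
2*triangle≡ (suc c) = begin
  2 * (suc c + triangle (suc c))      ≡⟨ *-distribˡ-+ 2 (suc c) (triangle (suc c)) ⟩
  2 * suc c + 2 * triangle (suc c)    ≡⟨ cong (2 * suc c +_) (2*triangle≡ c) ⟩
  2 * suc c + suc c * c               ≡⟨ step c ⟩
  suc (suc c) * suc c                 ∎
  where
  open ≡-Reasoning
  step : ∀ c → 2 * suc c + suc c * c ≡ suc (suc c) * suc c
  step = solve-∀

prime>2⇒∣triangle : Prime q → 2 < q → q ∣ triangle q
prime>2⇒∣triangle {suc q} pq q>2 =
  coprime-divisor (prime⇒coprime pq q>2) (divides q (trans (2*triangle≡ q) (*-comm (suc q) q)))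

geomSum-expansion : ∀ u c → ∃ λ z → geomSum (suc u) c ≡ c + u * (triangle c + u * z)
geomSum-expansion u zero    = 0 , sym (trans (cong (u *_) (*-zeroʳ u)) (*-zeroʳ u))
geomSum-expansion u (suc c) with geomSum-expansion u c
... | z , eq = z + triangle c + u * z , (begin
  1 + suc u * geomSum (suc u) c              ≡⟨ cong (λ g → 1 + suc u * g) eq ⟩
  1 + suc u * (c + u * (triangle c + u * z)) ≡⟨ step u c (triangle c) z ⟩
  suc c + u * ((c + triangle c) + u * (z + triangle c + u * z)) ∎)
  where
  open ≡-Reasoning
  step : ∀ u c t z → 1 + suc u * (c + u * (t + u * z)) ≡ suc c + u * ((c + t) + u * (z + t + u * z))
  step = solve-∀

geomSum≡*+ : ∀ u c → ∃ λ z → geomSum (suc u) c ≡ u * z + c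
geomSum≡*+ u c with geomSum-expansion u c
... | z , eq = triangle c + u * z , trans eq (+-comm c _)

geomSum-∣⇒∣ : q ∣ u → q ∣ geomSum (suc u) c → q ∣ c
geomSum-∣⇒∣ {q} {u} {c} q∣u q∣geom with geomSum≡*+ u c
... | z , eq = ∣m+n∣m⇒∣n (subst (q ∣_) eq q∣geom) (∣m⇒∣m*n z q∣u)

∣⇒geomSum-∣ : q ∣ u → q ∣ c → q ∣ geomSum (suc u) c
∣⇒geomSum-∣ {q} {u} {c} q∣u q∣c with geomSum≡*+ u c
... | z , eq = subst (q ∣_) (sym eq) (∣m∣n⇒∣m+n (∣m⇒∣m*n z q∣u) q∣c)

LTECondition : ℕ → ℕ → Set
LTECondition q w = 2 < q ⊎ q * q ∣ w

-- The two cases give q ∣ triangle q, resp. q² ∣ u, which kills the middle term of the expansion.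
geomSum≡q*[1+q*M] : Prime q → q ∣ u → LTECondition q u → ∃ λ M → geomSum (suc u) q ≡ q * (1 + q * M)
geomSum≡q*[1+q*M] {q} pq (divides μ refl) (inj₁ q>2)
  with geomSum-expansion (μ * q) q | prime>2⇒∣triangle pq q>2
... | z , eq | divides τ triangle≡ = μ * (τ + μ * z) , (begin
  geomSum (suc (μ * q)) q                            ≡⟨ eq ⟩
  q + μ * q * (triangle q + μ * q * z)               ≡⟨ cong (λ t → q + μ * q * (t + μ * q * z)) triangle≡ ⟩
  q + μ * q * (τ * q + μ * q * z)                    ≡⟨ step q μ τ z ⟩
  q * (1 + q * (μ * (τ + μ * z)))                    ∎)
  where
  open ≡-Reasoning
  step : ∀ q μ τ z → q + μ * q * (τ * q + μ * q * z) ≡ q * (1 + q * (μ * (τ + μ * z)))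
  step = solve-∀
geomSum≡q*[1+q*M] {q} {u} pq q∣u (inj₂ (divides ω u≡)) with geomSum-expansion u q
... | z , eq = ω * (triangle q + u * z) , (begin
  geomSum (suc u) q                                  ≡⟨ eq ⟩
  q + u * (triangle q + u * z)                       ≡⟨ cong (λ v → q + v * (triangle q + u * z)) u≡ ⟩
  q + ω * (q * q) * (triangle q + u * z)             ≡⟨ step q ω (triangle q + u * z) ⟩
  q * (1 + q * (ω * (triangle q + u * z)))           ∎)
  where
  open ≡-Reasoning
  step : ∀ q ω k → q + ω * (q * q) * k ≡ q * (1 + q * (ω * k))
  step = solve-∀

∸1∣^∸1 : ∀ s .{{_ : NonZero s}} n → s ∸ 1 ∣ s ^ n ∸ 1
∸1∣^∸1 s n = subst (_∣ s ^ n ∸ 1) (^1∸1≡∸1 s) (^∸1-monoʳ-∣ s (1∣ n))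

lte-coprime : .{{_ : NonZero s}} → Prime q → q ∣ s ^ a ∸ 1 → ¬ q ∣ c →
              q ^ x ∣ s ^ (a * c) ∸ 1 → q ^ x ∣ s ^ a ∸ 1
lte-coprime {s} {q} {a} {c} {x} pq q∣w q∤c h = coprime-divisor
  (coprime-^ˡ (prime∤⇒coprime pq (q∤c ∘ geomSum-∣⇒∣ q∣w)) x)
  (subst (q ^ x ∣_) (trans (^*∸1≡ s a c) (*-comm (s ^ a ∸ 1) _)) h)

lte-step : .{{_ : NonZero s}} → Prime q → q ∣ s ^ a ∸ 1 → LTECondition q (s ^ a ∸ 1) → ∀ x →
           q ^ suc x ∣ s ^ (a * q) ∸ 1 ⇔ q ^ x ∣ s ^ a ∸ 1
lte-step {s} {q} {a} pq q∣w cond x with geomSum≡q*[1+q*M] pq q∣w cond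
... | M , geomSum≡ = mk⇔
  (λ h → coprime-divisor (coprime-^ˡ (prime∤⇒coprime pq (prime∤1+q* pq M)) x)
           (subst (q ^ x ∣_) (*-comm W N) (*-cancelˡ-∣ q {{prime⇒nonZero pq}} (subst (q * q ^ x ∣_) eq h))))
  (λ h → subst (q * q ^ x ∣_) (sym eq) (*-monoʳ-∣ q (∣m⇒∣m*n N h)))
  where
  W = s ^ a ∸ 1
  N = 1 + q * M
  step : ∀ w q n → w * (q * n) ≡ q * (w * n)
  step = solve-∀
  eq : s ^ (a * q) ∸ 1 ≡ q * (W * N)
  eq = trans (^*∸1≡ s a q) (trans (cong (W *_) geomSum≡) (step W q N))

LTECondition-∣ : .{{_ : NonZero s}} → LTECondition q (s ^ a ∸ 1) → a ∣ n → LTECondition q (s ^ n ∸ 1)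
LTECondition-∣ (inj₁ q>2) _   = inj₁ q>2
LTECondition-∣ {s} (inj₂ q²∣) a∣n = inj₂ (∣-trans q²∣ (^∸1-monoʳ-∣ s a∣n))

lte : .{{_ : NonZero s}} → Prime q → q ∣ s ^ a ∸ 1 → LTECondition q (s ^ a ∸ 1) → ∀ u x →
      q ^ (u + x) ∣ s ^ (a * q ^ u) ∸ 1 ⇔ q ^ x ∣ s ^ a ∸ 1
lte {a = a} pq q∣w cond zero x rewrite *-identityʳ a = mk⇔ (λ h → h) (λ h → h)
lte {s} {q} {a} pq q∣w cond (suc u) x =
  lte {a = a} pq q∣w cond u x ⇔-∘
  subst (λ z → q ^ suc (u + x) ∣ s ^ z ∸ 1 ⇔ q ^ (u + x) ∣ s ^ a′ ∸ 1) (sym a*q^[1+u]≡)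
    (lte-step {a = a′} pq (∣-trans q∣w (^∸1-monoʳ-∣ s a∣a′)) (LTECondition-∣ cond a∣a′) (u + x))
  where
  a′ = a * q ^ u
  a∣a′ : a ∣ a′
  a∣a′ = m∣m*n (q ^ u)
  a*q^[1+u]≡ : a * (q * q ^ u) ≡ a′ * q
  a*q^[1+u]≡ = trans (cong (a *_) (*-comm q (q ^ u))) (sym (*-assoc a (q ^ u) q))

lte₁ : .{{_ : NonZero s}} → Prime q → q ∣ s ∸ 1 → LTECondition q (s ∸ 1) → ∀ u x →
       q ^ (u + x) ∣ s ^ (q ^ u) ∸ 1 ⇔ q ^ x ∣ s ∸ 1
lte₁ {s} {q} pq q∣ cond u x =
  subst₂ (λ X w → q ^ (u + x) ∣ X ⇔ q ^ x ∣ w) (cong (λ z → s ^ z ∸ 1) (*-identityˡ (q ^ u))) (^1∸1≡∸1 s)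
    (lte {a = 1} pq (subst (q ∣_) (sym (^1∸1≡∸1 s)) q∣) (subst (LTECondition q) (sym (^1∸1≡∸1 s)) cond) u x)

lte-step-≥ : .{{_ : NonZero s}} → q ∣ s ^ a ∸ 1 → q ^ x ∣ s ^ a ∸ 1 → q ^ suc x ∣ s ^ (a * q) ∸ 1
lte-step-≥ {s} {q} {a} {x} q∣w q^x∣w =
  subst (q ^ suc x ∣_) (sym (^*∸1≡ s a q))
    (subst (_∣ (s ^ a ∸ 1) * geomSum (suc (s ^ a ∸ 1)) q) (*-comm (q ^ x) q) (*-pres-∣ q^x∣w (∣⇒geomSum-∣ q∣w ∣-refl)))

lte-≥ : .{{_ : NonZero s}} → q ∣ s ∸ 1 → ∀ e → q ^ e ∣ s ^ (q ^ e) ∸ 1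
lte-≥ q∣ zero = 1∣ _
lte-≥ {s} {q} q∣ (suc e) = subst (λ z → q ^ suc e ∣ s ^ z ∸ 1) (*-comm (q ^ e) q)
  (lte-step-≥ {a = q ^ e} {x = e} (∣-trans q∣ (∸1∣^∸1 s (q ^ e))) (lte-≥ q∣ e))

prime≥2 : Prime q → 2 ≤ q
prime≥2 {q} pq = nonTrivial⇒n>1 q {{prime⇒nonTrivial pq}}

^∸1>0 : ∀ s n → 0 < s ∸ 1 → 0 < s ^ suc n ∸ 1
^∸1>0 s n s∸1>0 = subst (0 <_) (sym (^∸1≡pred*geomSum s (suc n))) (*-mono-≤ s∸1>0 (s≤s z≤n))

-- The hypothesis says ν q (X u) = ν q w + u. So γ = e ∸ ν q w is the least index with q ^ e ∣ X γ,
-- and q ^ (e + j) with j > 0 divides X γ only when γ = 0.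
valuation-threshold : 2 ≤ q → 0 < w → (X : ℕ → ℕ) → (∀ u x → q ^ (u + x) ∣ X u ⇔ q ^ x ∣ w) →
                      0 < j → ∀ e →
                      q ^ e ∣ X (e ∸ ν q w) × (q ^ (e + j) ∣ X (e ∸ ν q w) → e + j ≤ ν q w)
valuation-threshold {q} {w} {j} q≥2 w>0 X shift j>0 e = q^e∣X , q^[e+j]∣X⇒
  where
  V = ν q w
  γ = e ∸ V
  q^e∣X : q ^ e ∣ X γ
  q^e∣X = ∣-trans (^-monoʳ-∣ q (subst (e ≤_) (+-comm V γ) (m≤n+m∸n e V)))
                  (from (shift γ V) (≤ν⇒^∣ q≥2 w>0 ≤-refl))
  q^[e+j]∣X⇒ : q ^ (e + j) ∣ X γ → e + j ≤ V
  q^[e+j]∣X⇒ h with e ≤? V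
  ... | yes e≤V = ^∣⇒≤ν q≥2 w>0 (to (shift 0 (e + j)) (subst (λ z → q ^ (e + j) ∣ X z) (m≤n⇒m∸n≡0 e≤V) h))
  ... | no  e≰V = contradiction (^∣⇒≤ν q≥2 w>0 (to (shift γ (suc V)) (∣-trans (^-monoʳ-∣ q γ+1+V≤e+j) h))) 1+n≰n
    where
    γ+1+V≤e+j : γ + suc V ≤ e + j
    γ+1+V≤e+j = begin
      γ + suc V    ≡⟨ +-suc γ V ⟩
      suc (γ + V)  ≡⟨ cong suc (m∸n+n≡m (<⇒≤ (≰⇒> e≰V))) ⟩
      suc e        ≡⟨ +-comm 1 e ⟩
      e + 1        ≤⟨ +-monoʳ-≤ e j>0 ⟩
      e + j        ∎
      where open ≤-Reasoning

Condition₁ Condition₂ : (q s j e : ℕ) → Set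
Condition₁ q s j e = j + e ≤ ν q (s ∸ 1)
Condition₂ q s j e = (q ≡ 2) × (ν 2 (s ∸ 1) < e) × (e + j ≤ ν 2 (s ^ 2 ∸ 1))

Condition₃ : (q s k j e : ℕ) → Set
Condition₃ q s k j e = ∀ a b → IsOrd (q ^ (e + j)) s a → IsOrd k s b → a ∣ b

Threshold : (q s j e : ℕ) → Set
Threshold q s j e = ∃ λ γ → q ^ e ∣ s ^ (q ^ γ) ∸ 1 ×
                    (q ^ (e + j) ∣ s ^ (q ^ γ) ∸ 1 → Condition₁ q s j e ⊎ Condition₂ q s j e)

threshold-lte : .{{_ : NonZero s}} → Prime q → 0 < s ∸ 1 → q ∣ s ∸ 1 → LTECondition q (s ∸ 1) →
                0 < j → ∀ e → Threshold q s j e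
threshold-lte {s} {q} {j} pq s∸1>0 q∣s∸1 cond j>0 e
  with valuation-threshold (prime≥2 pq) s∸1>0 (λ γ → s ^ (q ^ γ) ∸ 1) (lte₁ pq q∣s∸1 cond) j>0 e
... | q^e∣ , e+j≤ν = e ∸ ν q (s ∸ 1) , q^e∣ , λ h → inj₁ (subst (_≤ ν q (s ∸ 1)) (+-comm e j) (e+j≤ν h))

-- For q = 2 with 4 ∤ s − 1 the LTE starts one step later, from s ^ 2 − 1.
threshold-2 : .{{_ : NonZero s}} → 0 < s ∸ 1 → 2 ∣ s ∸ 1 → ¬ 4 ∣ s ∸ 1 → 0 < j → ∀ e → Threshold 2 s j e
threshold-2 {s} {j} s∸1>0 2∣s∸1 4∤s∸1 j>0 e = by-cases (e ≤? 1)
  where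
  2∣s^1∸1 : 2 ∣ s ^ 1 ∸ 1
  2∣s^1∸1 = ∣-trans 2∣s∸1 (∸1∣^∸1 s 1)
  4∣s²∸1 : 4 ∣ s ^ 2 ∸ 1
  4∣s²∸1 = lte-step-≥ {a = 1} {x = 1} 2∣s^1∸1 2∣s^1∸1
  shift : ∀ u x → 2 ^ (u + x) ∣ s ^ (2 * 2 ^ u) ∸ 1 ⇔ 2 ^ x ∣ s ^ 2 ∸ 1
  shift = lte {a = 2} prime[2] (∣-trans 2∣s∸1 (∸1∣^∸1 s 2)) (inj₂ 4∣s²∸1)
  by-cases : Dec (e ≤ 1) → Threshold 2 s j e
  by-cases (yes e≤1) = 0 , ∣-trans (^-monoʳ-∣ 2 e≤1) 2∣s^1∸1 , λ h →
    inj₁ (subst (_≤ ν 2 (s ∸ 1)) (+-comm e j) (^∣⇒≤ν ≤-refl s∸1>0 (subst (2 ^ (e + j) ∣_) (^1∸1≡∸1 s) h)))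
  by-cases (no e≰1) with valuation-threshold ≤-refl (^∸1>0 s 1 s∸1>0) (λ γ → s ^ (2 * 2 ^ γ) ∸ 1) shift j>0 e
  ... | 2^e∣ , e+j≤ν = suc (e ∸ ν 2 (s ^ 2 ∸ 1)) , 2^e∣ , λ h → inj₂ (refl , ν<e , e+j≤ν h)
    where
    ν<e : ν 2 (s ∸ 1) < e
    ν<e = ≰⇒> λ e≤ν → 4∤s∸1 (∣-trans (^-monoʳ-∣ 2 (≰⇒> e≰1)) (≤ν⇒^∣ ≤-refl s∸1>0 e≤ν))

threshold : .{{_ : NonZero s}} → Prime q → 0 < s ∸ 1 → q ∣ s ∸ 1 → 0 < j → ∀ e → Threshold q s j e
threshold {s} {q} pq s∸1>0 q∣s∸1 j>0 e with 2 <? q | q * q ∣? s ∸ 1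
... | yes q>2 | _       = threshold-lte pq s∸1>0 q∣s∸1 (inj₁ q>2) j>0 e
... | no _    | yes q²∣ = threshold-lte pq s∸1>0 q∣s∸1 (inj₂ q²∣) j>0 e
... | no q≯2  | no q²∤ with ≤-antisym (≮⇒≥ q≯2) (prime≥2 pq)
...   | refl = threshold-2 s∸1>0 q∣s∸1 q²∤ j>0 e

-- b stands for ord_k s and c for the part of the other prime powers that is prime to q.
multiples⇒conditions : .{{_ : NonZero s}} → Prime q → 0 < s ∸ 1 → q ∣ s ∸ 1 → 0 < j → 0 < b → ¬ q ∣ c →
  (∀ n → q ^ e ∣ s ^ n ∸ 1 → b ∣ n → c ∣ n → q ^ (e + j) ∣ s ^ n ∸ 1) →
  Condition₁ q s j e ⊎ Condition₂ q s j e ⊎ q ^ (e + j) ∣ s ^ b ∸ 1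
multiples⇒conditions {s} {q} {j} {b} {c} {e} pq s∸1>0 q∣s∸1 j>0 b>0 q∤c H
  with threshold pq s∸1>0 q∣s∸1 j>0 e | ν-factorisation (prime≥2 pq) b>0
... | γ , q^e∣ , conditions | b′ , b≡ , q∤b′ = conclude (≤-total (ν q b) γ)
  where
  q^[e+j]∣ : ∀ d → ν q b ≤ d → γ ≤ d → q ^ (e + j) ∣ s ^ (q ^ d) ∸ 1
  q^[e+j]∣ d ν≤d γ≤d = lte-coprime {a = q ^ d} {x = e + j} pq (∣-trans q∣s∸1 (∸1∣^∸1 s (q ^ d))) q∤b′c
    (H (q ^ d * (b′ * c))
       (∣-trans q^e∣ (^∸1-monoʳ-∣ s (∣-trans (^-monoʳ-∣ q γ≤d) (m∣m*n (b′ * c)))))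
       (subst (_∣ q ^ d * (b′ * c)) (sym b≡) (*-pres-∣ (^-monoʳ-∣ q ν≤d) (m∣m*n c)))
       (∣n⇒∣m*n (q ^ d) (n∣m*n b′)))
    where
    q∤b′c : ¬ q ∣ b′ * c
    q∤b′c q∣b′c = [ q∤b′ , q∤c ]′ (euclidsLemma b′ c pq q∣b′c)
  conclude : ν q b ≤ γ ⊎ γ ≤ ν q b →
             Condition₁ q s j e ⊎ Condition₂ q s j e ⊎ q ^ (e + j) ∣ s ^ b ∸ 1
  conclude (inj₁ ν≤γ) = [ inj₁ , inj₂ ∘ inj₁ ]′ (conditions (q^[e+j]∣ γ ν≤γ ≤-refl))
  conclude (inj₂ γ≤ν) = inj₂ (inj₂ (∣-trans (q^[e+j]∣ (ν q b) ≤-refl γ≤ν)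
    (^∸1-monoʳ-∣ s (subst (q ^ ν q b ∣_) (sym b≡) (m∣m*n b′)))))

condition₁⇒∣ : .{{_ : NonZero s}} → Prime q → 0 < s ∸ 1 → Condition₁ q s j e → q ^ (e + j) ∣ s ^ n ∸ 1
condition₁⇒∣ {s} {q} {j} {e} {n} pq s∸1>0 c₁ =
  ∣-trans (≤ν⇒^∣ (prime≥2 pq) s∸1>0 (subst (_≤ ν q (s ∸ 1)) (+-comm j e) c₁)) (∸1∣^∸1 s n)

-- An odd n would give 2 ^ e ∣ s − 1 by the coprime case of the LTE, contradicting ν 2 (s − 1) < e.
condition₂⇒∣ : .{{_ : NonZero s}} → 0 < s ∸ 1 → q ∣ s ∸ 1 → Condition₂ q s j e →
               q ^ e ∣ s ^ n ∸ 1 → q ^ (e + j) ∣ s ^ n ∸ 1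
condition₂⇒∣ {s} {e = e} {n = n} s∸1>0 2∣s∸1 (refl , ν<e , e+j≤ν) 2^e∣ with 2 ∣? n
... | yes 2∣n = ∣-trans (≤ν⇒^∣ ≤-refl (^∸1>0 s 1 s∸1>0) e+j≤ν) (^∸1-monoʳ-∣ s 2∣n)
... | no  2∤n = contradiction
  (^∣⇒≤ν ≤-refl s∸1>0 (subst (2 ^ e ∣_) (^1∸1≡∸1 s)
    (lte-coprime {a = 1} {x = e} prime[2] (∣-trans 2∣s∸1 (∸1∣^∸1 s 1)) 2∤n
      (subst (λ z → 2 ^ e ∣ s ^ z ∸ 1) (sym (*-identityˡ n)) 2^e∣))))
  (<⇒≱ ν<e)

condition₃⇒∣ : .{{_ : NonZero s}} → Prime q → Coprime q s → 0 < k → Coprime k s →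
               Condition₃ q s k j e → k ∣ s ^ n ∸ 1 → q ^ (e + j) ∣ s ^ n ∸ 1
condition₃⇒∣ {s} {q} {k} {j} {e} {n} pq q⊥s k>0 k⊥s c₃ k∣
  with ord-exists (m^n>0 q {{prime⇒nonZero pq}} (e + j)) (coprime-^ˡ q⊥s (e + j)) | ord-exists k>0 k⊥s
... | a , ord-a | b , ord-b =
  ∣-trans (proj₁ (proj₂ ord-a)) (^∸1-monoʳ-∣ s (∣-trans (c₃ a b ord-a ord-b) (IsOrd-∣ {n = n} ord-b k∣)))

∣^ord∸1⇒condition₃ : .{{_ : NonZero s}} → IsOrd k s b → q ^ (e + j) ∣ s ^ b ∸ 1 → Condition₃ q s k j e
∣^ord∸1⇒condition₃ ord-b q^[e+j]∣ a b′ ord-a ord-b′ =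
  ∣-trans (IsOrd-∣ ord-a q^[e+j]∣) (IsOrd-∣ ord-b (proj₁ (proj₂ ord-b′)))

^+-∣-cancelˡ : Prime q → Coprime q c → q ^ e ∣ x ⇔ q ^ (e + j) ∣ q ^ j * (c * x)
^+-∣-cancelˡ {q} {c} {e} {x} {j} pq q⊥c = mk⇔
  (λ h → subst (_∣ q ^ j * (c * x)) (sym q^[e+j]≡) (*-monoʳ-∣ (q ^ j) (∣n⇒∣m*n c h)))
  (λ h → coprime-divisor (coprime-^ˡ q⊥c e)
           (*-cancelˡ-∣ (q ^ j) {{m^n≢0 q j {{prime⇒nonZero pq}}}} (subst (_∣ q ^ j * (c * x)) q^[e+j]≡ h)))
  where
  q^[e+j]≡ : q ^ (e + j) ≡ q ^ j * q ^ e
  q^[e+j]≡ = trans (^-distribˡ-+-* q e j) (*-comm (q ^ e) (q ^ j))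

quot≡/ : ∀ a b .{{_ : NonZero b}} → quot a b ≡ a / b
quot≡/ a (suc b) = refl

repunit≡geomSum : ∀ s m → 0 < s ∸ 1 → repunit s m ≡ geomSum s m
repunit≡geomSum (suc (suc z)) m _ = begin
  (suc (suc z) ^ m ∸ 1) / suc z            ≡⟨ cong (_/ suc z) (^∸1≡pred*geomSum (suc (suc z)) m) ⟩
  suc z * geomSum (suc (suc z)) m / suc z  ≡⟨ cong (_/ suc z) (*-comm (suc z) (geomSum (suc (suc z)) m)) ⟩
  geomSum (suc (suc z)) m * suc z / suc z  ≡⟨ m*n/n≡m (geomSum (suc (suc z)) m) (suc z) ⟩
  geomSum (suc (suc z)) m                  ∎
  where open ≡-Reasoning

module Setting
  (y t : ℕ) (t>0 : 0 < t) (t<1+y : t < suc y)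
  (n : ℕ) (p j : Fin n → ℕ) (prime : ∀ i → Prime (p i)) (p-injective : ∀ i i′ → p i ≡ p i′ → i ≡ i′)
  (j>0 : ∀ i → 0 < j i) (g≡∏ : gOf (suc y) t ≡ prodF n (λ i → p i ^ j i))
  (k : ℕ) (k>0 : 0 < k) (k⊥gs : Coprime k (gOf (suc y) t * suc y))
  (e : Fin n → ℕ) where

  y>0 : 0 < y
  y>0 = ≤-trans t>0 (s≤s⁻¹ t<1+y)

  d g t′ : ℕ
  d  = gcd y t
  instance
    d≢0 : NonZero d
    d≢0 = ≢-nonZero (gcd[m,n]≢0 y t (inj₂ (m<n⇒n≢0 t>0)))
  g  = y / d
  t′ = t / d

  gOf≡g : gOf (suc y) t ≡ g
  gOf≡g = quot≡/ y d

  y≡d*g : y ≡ d * g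
  y≡d*g = sym (m*[n/m]≡n (gcd[m,n]∣m y t))

  t≡d*t′ : t ≡ d * t′
  t≡d*t′ = sym (m*[n/m]≡n (gcd[m,n]∣n y t))

  k⊥g : Coprime k g
  k⊥g = coprime-∣ʳ k⊥gs (subst (_∣ gOf (suc y) t * suc y) gOf≡g (m∣m*n (suc y)))

  k⊥s : Coprime k (suc y)
  k⊥s = coprime-∣ʳ k⊥gs (n∣m*n (gOf (suc y) t))

  p∣g : ∀ i → p i ∣ g
  p∣g i = ∣-trans (q∣q^ (p i) (j>0 i)) (subst (p i ^ j i ∣_) (trans (sym g≡∏) gOf≡g) (∣prodF n _ i))

  p∣y : ∀ i → p i ∣ y
  p∣y i = ∣-trans (p∣g i) (subst (g ∣_) (sym y≡d*g) (n∣m*n d))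

  p^⊥p^ : ∀ {i l} a b → i ≢ l → Coprime (p i ^ a) (p l ^ b)
  p^⊥p^ {i} {l} a b i≢l =
    coprime-^ˡ (coprime-^ʳ (distinct-primes⇒coprime (prime i) (prime l) (i≢l ∘ p-injective i l)) b) a

  p^⊥t′ : ∀ i a → Coprime (p i ^ a) t′
  p^⊥t′ i a = coprime-^ˡ (Coprime.sym (coprime-∣ʳ (Coprime.sym (coprime-/gcd y t)) (p∣g i))) a

  g-split : ∀ i → ∃ λ c → g ≡ p i ^ j i * c × Coprime (p i) c
  g-split i with prodF-split n (λ l → p l ^ j l) i
                   (λ l l≢i → coprime-^ʳ (distinct-primes⇒coprime (prime i) (prime l) (l≢i ∘ sym ∘ p-injective i l)) (j l))
  ... | c , ∏≡ , p⊥c = c , trans (trans (sym gOf≡g) g≡∏) ∏≡ , p⊥c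

  P r : ℕ
  P = prodF n (λ i → p i ^ e i)
  r = P * k

  P⊥k : Coprime P k
  P⊥k = Coprime.sym (coprime-prodF n _ (λ i → coprime-^ʳ (coprime-∣ʳ k⊥g (p∣g i)) (e i)))

  r⊥s : Coprime r (suc y)
  r⊥s = Coprime.sym (coprime-*ʳ
    (coprime-prodF n _ (λ i → Coprime.sym (coprime-^ˡ (∣n⇒coprime-1+n (p∣y i)) (e i))))
    (Coprime.sym k⊥s))

  p^e∣r : ∀ i → p i ^ e i ∣ r
  p^e∣r i = ∣-trans (∣prodF n _ i) (m∣m*n k)

  prime-powers⇒r∣ : ∀ {x} → (∀ i → p i ^ e i ∣ x) → k ∣ x → r ∣ x
  prime-powers⇒r∣ p^e∣ k∣ = coprime-*-∣ P⊥k (prodF-∣ n _ (λ i l → p^⊥p^ (e i) (e l)) p^e∣) k∣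

  ^∸1≡g*[d*R] : ∀ m → suc y ^ m ∸ 1 ≡ g * (d * geomSum (suc y) m)
  ^∸1≡g*[d*R] m = trans (^∸1≡pred*geomSum (suc y) m)
    (trans (cong (_* geomSum (suc y) m) y≡d*g) (step d g (geomSum (suc y) m)))
    where
    step : ∀ d g R → d * g * R ≡ g * (d * R)
    step = solve-∀

  t*repunit≡t′*[d*R] : ∀ m → t * repunit (suc y) m ≡ t′ * (d * geomSum (suc y) m)
  t*repunit≡t′*[d*R] m = trans (cong₂ _*_ t≡d*t′ (repunit≡geomSum (suc y) m y>0))
    (step d t′ (geomSum (suc y) m))
    where
    step : ∀ d t R → d * t * R ≡ t * (d * R)
    step = solve-∀

  p^e∣d*R⇔ : ∀ m i → p i ^ e i ∣ d * geomSum (suc y) m ⇔ p i ^ (e i + j i) ∣ suc y ^ m ∸ 1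
  p^e∣d*R⇔ m i with g-split i
  ... | c , g≡ , p⊥c = subst (λ z → p i ^ e i ∣ d * geomSum (suc y) m ⇔ p i ^ (e i + j i) ∣ z)
    (sym s^m∸1≡) (^+-∣-cancelˡ {e = e i} {j = j i} (prime i) p⊥c)
    where
    s^m∸1≡ : suc y ^ m ∸ 1 ≡ p i ^ j i * (c * (d * geomSum (suc y) m))
    s^m∸1≡ = trans (^∸1≡g*[d*R] m) (trans (cong (_* (d * geomSum (suc y) m)) g≡) (*-assoc (p i ^ j i) c _))

  r∣t*repunit⇒p^[e+j]∣ : ∀ m → r ∣ t * repunit (suc y) m → ∀ i → p i ^ (e i + j i) ∣ suc y ^ m ∸ 1
  r∣t*repunit⇒p^[e+j]∣ m r∣ i = to (p^e∣d*R⇔ m i)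
    (coprime-divisor (p^⊥t′ i (e i)) (subst (p i ^ e i ∣_) (t*repunit≡t′*[d*R] m) (∣-trans (p^e∣r i) r∣)))

  p^[e+j]∣⇒r∣t*repunit : ∀ m → (∀ i → p i ^ (e i + j i) ∣ suc y ^ m ∸ 1) → k ∣ suc y ^ m ∸ 1 →
                         r ∣ t * repunit (suc y) m
  p^[e+j]∣⇒r∣t*repunit m p^[e+j]∣ k∣ = subst (r ∣_) (sym (t*repunit≡t′*[d*R] m)) (∣n⇒∣m*n t′
    (prime-powers⇒r∣ (λ i → from (p^e∣d*R⇔ m i) (p^[e+j]∣ i))
      (coprime-divisor k⊥g (subst (k ∣_) (^∸1≡g*[d*R] m) k∣))))

  Conditions : Fin n → Set
  Conditions i = Condition₁ (p i) (suc y) (j i) (e i) ⊎ Condition₂ (p i) (suc y) (j i) (e i)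
               ⊎ Condition₃ (p i) (suc y) k (j i) (e i)

  -- For i fixed, r ∣ s ^ N − 1 as soon as p i ^ e i ∣ s ^ N − 1, ord_k s ∣ N and the other prime
  -- powers divide N, since each p l ^ e l divides s ^ (p l ^ e l) − 1.
  distinguished⇒conditions : Distinguished r (suc y) t → ∀ i → Conditions i
  distinguished⇒conditions (r≥2 , _ , r∣t*repunit) i
    with ord-exists (≤-trans z<s r≥2) r⊥s | ord-exists k>0 k⊥s
       | ν-factorisation (prime≥2 (prime i)) (prodF-pos n (λ l → p l ^ e l) (λ l → m^n>0 (p l) {{prime⇒nonZero (prime l)}} (e l)))
  ... | m₀ , ord-m₀ | b₀ , ord-b₀ | P′ , P≡ , p∤P′ =
    [ inj₁ , inj₂ ∘ [ inj₁ , inj₂ ∘ ∣^ord∸1⇒condition₃ {e = e i} {j = j i} ord-b₀ ]′ ]′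
      (multiples⇒conditions {e = e i} (prime i) y>0 (p∣y i) (j>0 i) (proj₁ ord-b₀) p∤P′ p^[e+j]∣)
    where
    p^e∣P′ : ∀ l → l ≢ i → p l ^ e l ∣ P′
    p^e∣P′ l l≢i = coprime-divisor (p^⊥p^ (e l) (ν (p i) P) l≢i) (subst (p l ^ e l ∣_) P≡ (∣prodF n _ l))
    p^[e+j]∣ : ∀ N → p i ^ e i ∣ suc y ^ N ∸ 1 → b₀ ∣ N → P′ ∣ N → p i ^ (e i + j i) ∣ suc y ^ N ∸ 1
    p^[e+j]∣ N p^e∣ b₀∣N P′∣N =
      ∣-trans (r∣t*repunit⇒p^[e+j]∣ m₀ (r∣t*repunit m₀ ord-m₀) i) (^∸1-monoʳ-∣ (suc y) (IsOrd-∣ {n = N} ord-m₀ r∣))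
      where
      p^e∣ₗ : ∀ l → p l ^ e l ∣ suc y ^ N ∸ 1
      p^e∣ₗ l with l Fin.≟ i
      ... | yes refl = p^e∣
      ... | no  l≢i  = ∣-trans (lte-≥ (p∣y l) (e l)) (^∸1-monoʳ-∣ (suc y) (∣-trans (p^e∣P′ l l≢i) P′∣N))
      r∣ : r ∣ suc y ^ N ∸ 1
      r∣ = prime-powers⇒r∣ p^e∣ₗ (∣-trans (proj₁ (proj₂ ord-b₀)) (^∸1-monoʳ-∣ (suc y) b₀∣N))

  conditions⇒distinguished : 2 ≤ r → (∀ i → Conditions i) → Distinguished r (suc y) t
  conditions⇒distinguished r≥2 conditions = r≥2 , r⊥s , r∣t*repunit
    where
    r∣t*repunit : ∀ m → IsOrd r (suc y) m → r ∣ t * repunit (suc y) m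
    r∣t*repunit m (_ , r∣ , _) = p^[e+j]∣⇒r∣t*repunit m (λ i → p^[e+j]∣ i (conditions i)) k∣
      where
      k∣ : k ∣ suc y ^ m ∸ 1
      k∣ = ∣-trans (n∣m*n P) r∣
      p^[e+j]∣ : ∀ i → Conditions i → p i ^ (e i + j i) ∣ suc y ^ m ∸ 1
      p^[e+j]∣ i (inj₁ c₁)        = condition₁⇒∣ {j = j i} {e = e i} {n = m} (prime i) y>0 c₁
      p^[e+j]∣ i (inj₂ (inj₁ c₂)) = condition₂⇒∣ {n = m} y>0 (p∣y i) c₂ (∣-trans (p^e∣r i) r∣)
      p^[e+j]∣ i (inj₂ (inj₂ c₃)) = condition₃⇒∣ {j = j i} {e = e i} {n = m} (prime i) (∣n⇒coprime-1+n (p∣y i)) k>0 k⊥s c₃ k∣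

proposition3p12 :
    (s t : ℕ) → 0 < t → t < s →
    (n : ℕ) (p j : Fin n → ℕ) →
    (∀ i → Prime (p i)) →
    (∀ i i′ → p i ≡ p i′ → i ≡ i′) →
    (∀ i → 1 ≤ j i) →
    gOf s t ≡ prodF n (λ i → p i ^ j i) →
    (k : ℕ) → 0 < k → Coprime k (gOf s t * s) →
    (e : Fin n → ℕ) →
    2 ≤ prodF n (λ i → p i ^ e i) * k →
    (Distinguished (prodF n (λ i → p i ^ e i) * k) s t
      ⇔ (∀ i →
           (j i + e i ≤ ν (p i) (s ∸ 1))
         ⊎ ((p i ≡ 2) × (ν 2 (s ∸ 1) < e i) × (e i + j i ≤ ν 2 (s ^ 2 ∸ 1)))
         ⊎ (∀ a b → IsOrd (p i ^ (e i + j i)) s a → IsOrd k s b → a ∣ b)))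
proposition3p12 zero    t t>0 ()
proposition3p12 (suc y) t t>0 t<s n p j prime p-injective j>0 g≡∏ k k>0 k⊥gs e r≥2 =
  mk⇔ distinguished⇒conditions (conditions⇒distinguished r≥2)
  where open Setting y t t>0 t<s n p j prime p-injective j>0 g≡∏ k k>0 k⊥gs e
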